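{- Let $q\ge1$, $S\subseteq[q]^3$, and $a,b\in[q]$ with $a\neq b$, and assume $H_q(a,b;S)$ holds. Let $X:=L_q(S)\subseteq[2q]^3$ and \[ T:=\bigl(X\cup\{P_1,P_2,P_3\}\bigr)\setminus\{M_1,M_2,M_3,M_4\}, \] where $P_1=(2b,2b,2b+1)$, $P_2=(2b+1,2b,2b+1)$, $P_3=(2b+1,2a+1,2a)$, $M_1=(2a+1,2a,2a)$, $M_2=(2a+1,2a,2a+1)$, $M_3=(2b,2b+1,2a)$, $M_4=(2b,2b+1,2a+1)$. Then \[ N_{2q}(T)=16\,N_q(S)+1. \]
   Context: $[q]:=\{0,\dots,q-1\}$. For $S\subseteq[q]^3$, $N_q(S)$ is the number of $(x_1,x_2,x_3,x_4)\in[q]^4$ with $(x_1,x_2,x_3)\in S$ and $(x_2,x_3,x_4)\notin S$ (analogously $N_{2q}$ on $[2q]$). For $u,v\in[q]$: $I_S(u,v):=\#\{x\in[q]:(x,u,v)\in S\}$, $O_S(u,v):=\#\{y\in[q]:(u,v,y)\in S\}$. The dyadic lift $L_q(S)\subseteq[2q]^3$: $(r,s,t)\in L_q(S)$ iff $(\lfloor r/2\rfloor,\lfloor s/2\rfloor,\lfloor t/2\rfloor)\in S$. For $a\ne b$, $H_q(a,b;S)$ means: (i) $(a,a,a)\in S$, $(b,b,a)\in S$, $(b,a,a)\notin S$, $(b,b,b)\notin S$; (ii) $I_S(a,a)+O_S(a,a)=q$; (iii) $I_S(b,b)+O_S(b,b)=q$; (iv) $I_S(b,b)+O_S(b,a)=q-1$;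 (v) $I_S(b,a)+O_S(a,a)=q+1$. -}

module Defs where

open import Data.Nat using (ℕ; zero; suc; _+_; _*_; _/_; _≡ᵇ_)
open import Relation.Binary.PropositionalEquality using (_≡_)
open import Data.Bool using (Bool; true; false; _∧_; _∨_; not; if_then_else_)

-- A subset of [q]^3 is represented by its (decidable) characteristic
-- function on triples of naturals; only values on [q]^3 are ever consulted.
Triples : Set
Triples = ℕ → ℕ → ℕ → Bool

sumTo : ℕ → (ℕ → ℕ) → ℕ
sumTo zero    f = 0
sumTo (suc n) f = sumTo n f + f n

ind : Bool → ℕ
ind b = if b then 1 else 0

count : ℕ → (ℕ → Bool) → ℕ
count n P = sumTo n (λ x → ind (P x))

Ncount : ℕ → Triples → ℕ
Ncount n S =
  sumTo n λ x1 → sumTo n λ x2 → sumTo n λ x3 →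
    count n λ x4 → S x1 x2 x3 ∧ not (S x2 x3 x4)

I : ℕ → Triples → ℕ → ℕ → ℕ
I q S u v = count q λ x → S x u v

O : ℕ → Triples → ℕ → ℕ → ℕ
O q S u v = count q λ y → S u v y

lift : Triples → Triples
lift S r s t = S (r / 2) (s / 2) (t / 2)

eq3 : ℕ → ℕ → ℕ → ℕ → ℕ → ℕ → Bool
eq3 r s t r' s' t' = (r ≡ᵇ r') ∧ (s ≡ᵇ s') ∧ (t ≡ᵇ t')

record H (q a b : ℕ) (S : Triples) : Set where
  field
    aaa∈  : S a a a ≡ true
    bba∈  : S b b a ≡ true
    baa∉  : S b a a ≡ false
    bbb∉  : S b b b ≡ false
    cond2 : I q S a a + O q S a a ≡ q
    cond3 : I q S b b + O q S b b ≡ q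
    -- (iv) I_S(b,b) + O_S(b,a) = q - 1, stated without truncated subtraction
    cond4 : I q S b b + O q S b a + 1 ≡ q
    cond5 : I q S b a + O q S a a ≡ q + 1

Tset : ℕ → ℕ → Triples → Triples
Tset a b S r s t =
  (lift S r s t
    ∨ eq3 r s t (2 * b) (2 * b) (2 * b + 1)
    ∨ eq3 r s t (2 * b + 1) (2 * b) (2 * b + 1)
    ∨ eq3 r s t (2 * b + 1) (2 * a + 1) (2 * a))
  ∧ not (eq3 r s t (2 * a + 1) (2 * a) (2 * a)
       ∨ eq3 r s t (2 * a + 1) (2 * a) (2 * a + 1)
       ∨ eq3 r s t (2 * b) (2 * b + 1) (2 * a)
       ∨ eq3 r s t (2 * b) (2 * b + 1) (2 * a + 1))

module Submission where

-- Write N_n(S) = Σ_{u,v} I_S(u,v) · Oᶜ_S(u,v), where Oᶜ_S(u,v) counts the y with (u,v,y) ∉ S.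
-- Under the dyadic lift both factors double at every pair, so N_2q(X) = 16 N_q(S) for X = L_q(S).
-- T is X with the P_i (which lie outside X) inserted and the M_j (which lie in X) deleted.
-- Inserting or deleting (r,s,t) moves I by one at (s,t) and Oᶜ by one at (r,s); expanding the
-- products shows that N(T) − N(X) is a signed sum of values of I_X and Oᶜ_X at these pairs plus a
-- signed count of coincidences between them. The values at the relevant pairs are twice those of
-- I_S, Oᶜ_S at (a,a), (b,b), (b,a), which H ties to i = I_S(a,a) and j = I_S(b,b): the value terms
-- add up to −6 independently of i and j, and the coincidences to 7.

open import Algebra.Properties.CommutativeSemigroup using (interchange)
open import Data.Bool using (Bool; true; false; _∧_; _∨_; not)
open import Data.Bool.ListAction using (any)
open import Data.Bool.Properties using (T-≡; ∧-assoc; ∧-comm; ∨-identityʳ)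
import Data.Bool.Properties as Bool
open import Data.List using (List; []; _∷_; _++_; map)
open import Data.List.Properties using (map-cong)
open import Data.List.Relation.Unary.All using (All; []; _∷_)
import Data.List.Relation.Unary.All as All
import Data.List.Relation.Unary.All.Properties as All
open import Data.Nat using (ℕ; zero; suc; _+_; _*_; _/_; _%_; _≡ᵇ_; _<_; _≤_; _≥_; _≟_; z≤n; s≤s; s≤s⁻¹)
open import Data.Nat.DivMod using (/-congˡ; %-congˡ; m*n/n≡m; m*n%n≡0; [m+kn]%n≡m%n; +-distrib-/-∣ˡ)
open import Data.Nat.Divisibility using (m∣m*n)
open import Data.Nat.ListAction using (sum)
open import Data.Nat.Properties
open import Data.Nat.Tactic.RingSolver using (solve-∀)
open import Data.Product using (_×_; _,_; proj₂; uncurry)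
open import Data.Product.Properties using (≡-dec; ×-≡,≡→≡)
open import Data.Sum using (_⊎_; inj₁; inj₂)
open import Function using (_∘_)
open import Function.Bundles using (Equivalence; mk⇔)
open import Relation.Binary.PropositionalEquality
open import Relation.Nullary using (yes; no; does; contradiction)
open import Relation.Nullary.Decidable using (dec-true; dec-false; does-⇔)

open import Defs

+-cong₅ : ∀ {a a′ b b′ c c′ d d′ e e′ : ℕ} → a ≡ a′ → b ≡ b′ → c ≡ c′ → d ≡ d′ → e ≡ e′ →
  a + b + c + d + e ≡ a′ + b′ + c′ + d′ + e′
+-cong₅ refl refl refl refl refl = refl

+-interchange : ∀ w x y z → w + x + (y + z) ≡ w + y + (x + z)
+-interchange = interchange +-commutativeSemigroup

≡ᵇ-true : ∀ {m n} → m ≡ n → (m ≡ᵇ n) ≡ true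
≡ᵇ-true {m} {n} = dec-true (m ≟ n)

≡ᵇ-false : ∀ {m n} → m ≢ n → (m ≡ᵇ n) ≡ false
≡ᵇ-false {m} {n} = dec-false (m ≟ n)

ind-∧ : ∀ x y → ind (x ∧ y) ≡ ind x * ind y
ind-∧ true  y = sym (+-identityʳ (ind y))
ind-∧ false y = refl

ind-not : ∀ x → ind (not x) + ind x ≡ 1
ind-not true  = refl
ind-not false = refl

sumTo-cong : ∀ n {f g : ℕ → ℕ} → (∀ i → f i ≡ g i) → sumTo n f ≡ sumTo n g
sumTo-cong zero    f≗g = refl
sumTo-cong (suc n) f≗g = cong₂ _+_ (sumTo-cong n f≗g) (f≗g n)

sumTo-zero : ∀ n → sumTo n (λ _ → 0) ≡ 0
sumTo-zero zero    = refl
sumTo-zero (suc n) = cong (_+ 0) (sumTo-zero n)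

sumTo-distrib-+ : ∀ n (f g : ℕ → ℕ) → sumTo n (λ i → f i + g i) ≡ sumTo n f + sumTo n g
sumTo-distrib-+ zero    f g = refl
sumTo-distrib-+ (suc n) f g =
  trans (cong (_+ (f n + g n)) (sumTo-distrib-+ n f g))
        (+-interchange (sumTo n f) (sumTo n g) (f n) (g n))

sumTo-*ˡ : ∀ n c (f : ℕ → ℕ) → sumTo n (λ i → c * f i) ≡ c * sumTo n f
sumTo-*ˡ zero    c f = sym (*-zeroʳ c)
sumTo-*ˡ (suc n) c f =
  trans (cong (_+ c * f n) (sumTo-*ˡ n c f)) (sym (*-distribˡ-+ c (sumTo n f) (f n)))

sumTo-swap : ∀ m n (f : ℕ → ℕ → ℕ) →
  sumTo m (λ i → sumTo n (f i)) ≡ sumTo n (λ j → sumTo m (λ i → f i j))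
sumTo-swap zero    n f = sym (sumTo-zero n)
sumTo-swap (suc m) n f =
  trans (cong (_+ sumTo n (f m)) (sumTo-swap m n f))
        (sym (sumTo-distrib-+ n (λ j → sumTo m (λ i → f i j)) (f m)))

sumTo-sift-miss : ∀ {n k} (f : ℕ → ℕ) → n ≤ k → sumTo n (λ i → ind (i ≡ᵇ k) * f i) ≡ 0
sumTo-sift-miss {zero}  f _   = refl
sumTo-sift-miss {suc n} f n<k
  rewrite ≡ᵇ-false (<⇒≢ n<k) = trans (+-identityʳ _) (sumTo-sift-miss f (<⇒≤ n<k))

sumTo-sift : ∀ {n k} (f : ℕ → ℕ) → k < n → sumTo n (λ i → ind (i ≡ᵇ k) * f i) ≡ f k
sumTo-sift {suc n} {k} f k<1+n with k ≟ n
... | yes refl rewrite ≡ᵇ-true (refl {x = k}) | sumTo-sift-miss f (≤-refl {k}) = +-identityʳ (f k)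
... | no k≢n rewrite ≡ᵇ-false (k≢n ∘ sym) =
  trans (+-identityʳ _) (sumTo-sift f (≤∧≢⇒< (s≤s⁻¹ k<1+n) k≢n))

sumTo-*ʳ : ∀ n c (f : ℕ → ℕ) → sumTo n (λ i → f i * c) ≡ sumTo n f * c
sumTo-*ʳ n c f =
  trans (sumTo-cong n (λ i → *-comm (f i) c)) (trans (sumTo-*ˡ n c f) (*-comm c (sumTo n f)))

count-∧ˡ : ∀ n c (P : ℕ → Bool) → count n (λ x → c ∧ P x) ≡ ind c * count n P
count-∧ˡ n true  P = sym (*-identityˡ (count n P))
count-∧ˡ n false P = sumTo-zero n

count-sift : ∀ {n k} c → k < n → count n (λ x → (x ≡ᵇ k) ∧ c) ≡ ind c
count-sift {n} {k} c k<n =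
  trans (sumTo-cong n (λ x → ind-∧ (x ≡ᵇ k) c)) (sumTo-sift (λ _ → ind c) k<n)

count-not : ∀ n (P : ℕ → Bool) → count n (λ x → not (P x)) + count n P ≡ n
count-not zero    P = refl
count-not (suc n) P = begin
  count n (not ∘ P) + ind (not (P n)) + (count n P + ind (P n))
    ≡⟨ +-interchange (count n (not ∘ P)) (ind (not (P n))) (count n P) (ind (P n)) ⟩
  count n (not ∘ P) + count n P + (ind (not (P n)) + ind (P n))
    ≡⟨ cong₂ _+_ (count-not n P) (ind-not (P n)) ⟩
  n + 1
    ≡⟨ +-comm n 1 ⟩
  suc n ∎
  where open ≡-Reasoning

ΣΣ : ℕ → (ℕ → ℕ → ℕ) → ℕ
ΣΣ n F = sumTo n λ u → sumTo n λ v → F u v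

ΣΣ-cong : ∀ n {F G : ℕ → ℕ → ℕ} → (∀ u v → F u v ≡ G u v) → ΣΣ n F ≡ ΣΣ n G
ΣΣ-cong n F≗G = sumTo-cong n (λ u → sumTo-cong n (F≗G u))

ΣΣ-distrib-+ : ∀ n (F G : ℕ → ℕ → ℕ) → ΣΣ n (λ u v → F u v + G u v) ≡ ΣΣ n F + ΣΣ n G
ΣΣ-distrib-+ n F G =
  trans (sumTo-cong n (λ u → sumTo-distrib-+ n (F u) (G u))) (sumTo-distrib-+ n _ _)

-- N as a sum over pairs

Oᶜ : ℕ → Triples → ℕ → ℕ → ℕ
Oᶜ n S u v = count n λ y → not (S u v y)

Oᶜ+O : ∀ n S u v → Oᶜ n S u v + O n S u v ≡ n
Oᶜ+O n S u v = count-not n (S u v)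

Ncount≡ΣΣ-I*Oᶜ : ∀ n S → Ncount n S ≡ ΣΣ n (λ u v → I n S u v * Oᶜ n S u v)
Ncount≡ΣΣ-I*Oᶜ n S = begin
  Ncount n S
    ≡⟨ sumTo-cong n (λ x → ΣΣ-cong n (λ u v → count-∧ˡ n (S x u v) (λ y → not (S u v y)))) ⟩
  sumTo n (λ x → ΣΣ n (λ u v → ind (S x u v) * Oᶜ n S u v))
    ≡⟨ sumTo-swap n n _ ⟩
  sumTo n (λ u → sumTo n (λ x → sumTo n (λ v → ind (S x u v) * Oᶜ n S u v)))
    ≡⟨ sumTo-cong n (λ u → sumTo-swap n n _) ⟩
  ΣΣ n (λ u v → sumTo n (λ x → ind (S x u v) * Oᶜ n S u v))
    ≡⟨ ΣΣ-cong n (λ u v → sumTo-*ʳ n (Oᶜ n S u v) (λ x → ind (S x u v))) ⟩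
  ΣΣ n (λ u v → I n S u v * Oᶜ n S u v) ∎
  where open ≡-Reasoning

-- The dyadic lift

2*n/2≡n : ∀ n → 2 * n / 2 ≡ n
2*n/2≡n n = trans (/-congˡ (*-comm 2 n)) (m*n/n≡m n 2)

[2*n+1]/2≡n : ∀ n → (2 * n + 1) / 2 ≡ n
[2*n+1]/2≡n n =
  trans (+-distrib-/-∣ˡ 1 (m∣m*n n)) (trans (+-identityʳ (2 * n / 2)) (2*n/2≡n n))

sumTo-double : ∀ q (f : ℕ → ℕ) → sumTo (2 * q) f ≡ sumTo q (λ i → f (2 * i) + f (2 * i + 1))
sumTo-double zero    f = refl
sumTo-double (suc q) f = begin
  sumTo (2 * suc q) f
    ≡⟨ cong (λ m → sumTo m f) (*-suc 2 q) ⟩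
  sumTo (2 * q) f + f (2 * q) + f (suc (2 * q))
    ≡⟨ +-assoc (sumTo (2 * q) f) (f (2 * q)) (f (suc (2 * q))) ⟩
  sumTo (2 * q) f + (f (2 * q) + f (suc (2 * q)))
    ≡⟨ cong₂ _+_ (sumTo-double q f) (cong (λ m → f (2 * q) + f m) (+-comm 1 (2 * q))) ⟩
  sumTo q (λ i → f (2 * i) + f (2 * i + 1)) + (f (2 * q) + f (2 * q + 1)) ∎
  where open ≡-Reasoning

sumTo-halve : ∀ q (f : ℕ → ℕ) → sumTo (2 * q) (λ x → f (x / 2)) ≡ 2 * sumTo q f
sumTo-halve q f = begin
  sumTo (2 * q) (λ x → f (x / 2))
    ≡⟨ sumTo-double q (λ x → f (x / 2)) ⟩
  sumTo q (λ i → f (2 * i / 2) + f ((2 * i + 1) / 2))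
    ≡⟨ sumTo-cong q (λ i → cong₂ (λ x y → f x + f y) (2*n/2≡n i) ([2*n+1]/2≡n i)) ⟩
  sumTo q (λ i → f i + f i)
    ≡⟨ sumTo-cong q (λ i → cong (f i +_) (sym (+-identityʳ (f i)))) ⟩
  sumTo q (λ i → 2 * f i)
    ≡⟨ sumTo-*ˡ q 2 f ⟩
  2 * sumTo q f ∎
  where open ≡-Reasoning

ΣΣ-halve : ∀ q (F : ℕ → ℕ → ℕ) → ΣΣ (2 * q) (λ u v → F (u / 2) (v / 2)) ≡ 4 * ΣΣ q F
ΣΣ-halve q F = begin
  ΣΣ (2 * q) (λ u v → F (u / 2) (v / 2))
    ≡⟨ sumTo-cong (2 * q) (λ u → sumTo-halve q (F (u / 2))) ⟩
  sumTo (2 * q) (λ u → 2 * sumTo q (F (u / 2)))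
    ≡⟨ sumTo-halve q (λ u → 2 * sumTo q (F u)) ⟩
  2 * sumTo q (λ u → 2 * sumTo q (F u))
    ≡⟨ cong (2 *_) (sumTo-*ˡ q 2 (λ u → sumTo q (F u))) ⟩
  2 * (2 * ΣΣ q F)
    ≡⟨ *-assoc 2 2 (ΣΣ q F) ⟨
  4 * ΣΣ q F ∎
  where open ≡-Reasoning

I-lift : ∀ q S u v → I (2 * q) (lift S) u v ≡ 2 * I q S (u / 2) (v / 2)
I-lift q S u v = sumTo-halve q (λ x → ind (S x (u / 2) (v / 2)))

Oᶜ-lift : ∀ q S u v → Oᶜ (2 * q) (lift S) u v ≡ 2 * Oᶜ q S (u / 2) (v / 2)
Oᶜ-lift q S u v = sumTo-halve q (λ y → ind (not (S (u / 2) (v / 2) y)))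

Ncount-lift : ∀ q S → Ncount (2 * q) (lift S) ≡ 16 * Ncount q S
Ncount-lift q S = begin
  Ncount (2 * q) (lift S)
    ≡⟨ Ncount≡ΣΣ-I*Oᶜ (2 * q) (lift S) ⟩
  ΣΣ (2 * q) (λ u v → I (2 * q) (lift S) u v * Oᶜ (2 * q) (lift S) u v)
    ≡⟨ ΣΣ-cong (2 * q) (λ u v → trans (cong₂ _*_ (I-lift q S u v) (Oᶜ-lift q S u v))
                                        (2x*2y≡4xy (I q S (u / 2) (v / 2)) (Oᶜ q S (u / 2) (v / 2)))) ⟩
  ΣΣ (2 * q) (λ u v → 4 * (I q S (u / 2) (v / 2) * Oᶜ q S (u / 2) (v / 2)))
    ≡⟨ trans (sumTo-cong (2 * q) (λ u → sumTo-*ˡ (2 * q) 4 _)) (sumTo-*ˡ (2 * q) 4 _) ⟩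
  4 * ΣΣ (2 * q) (λ u v → I q S (u / 2) (v / 2) * Oᶜ q S (u / 2) (v / 2))
    ≡⟨ cong (4 *_) (ΣΣ-halve q (λ u v → I q S u v * Oᶜ q S u v)) ⟩
  4 * (4 * ΣΣ q (λ u v → I q S u v * Oᶜ q S u v))
    ≡⟨ *-assoc 4 4 (ΣΣ q (λ u v → I q S u v * Oᶜ q S u v)) ⟨
  16 * ΣΣ q (λ u v → I q S u v * Oᶜ q S u v)
    ≡⟨ cong (16 *_) (Ncount≡ΣΣ-I*Oᶜ q S) ⟨
  16 * Ncount q S ∎
  where
  open ≡-Reasoning
  2x*2y≡4xy : ∀ x y → 2 * x * (2 * y) ≡ 4 * (x * y)
  2x*2y≡4xy = solve-∀

Point : Set
Point = ℕ × ℕ × ℕ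

_⟨_⟩ : Triples → Point → Bool
S ⟨ r , s , t ⟩ = S r s t

head : {A : Set} → A × A × A → A × A
head (r , s , _) = r , s

tail : {A : Set} → A × A × A → A × A
tail (_ , s , t) = s , t

pairTest : {A : Set} → (A → A → Bool) → A × A → A × A → Bool
pairTest _==_ (u , v) (s , t) = (u == s) ∧ (v == t)

tripleTest : {A : Set} → (A → A → Bool) → A × A × A → A × A × A → Bool
tripleTest _==_ (r , p) (r′ , p′) = (r == r′) ∧ pairTest _==_ p p′

_≡ᵇ²_ : ℕ × ℕ → ℕ × ℕ → Bool
_≡ᵇ²_ = pairTest _≡ᵇ_

_≡ᵇ³_ : Point → Point → Bool
_≡ᵇ³_ = tripleTest _≡ᵇ_

occ : {A : Set} → (A → A → Bool) → List A → A → ℕ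
occ _==_ []       p = 0
occ _==_ (q ∷ qs) p = ind (p == q) + occ _==_ qs p

matches : {A : Set} → (A → A → Bool) → List A → List A → ℕ
matches _==_ xs ys = sum (map (occ _==_ ys) xs)

occ-++ : ∀ {A : Set} (_==_ : A → A → Bool) xs ys p →
  occ _==_ (xs ++ ys) p ≡ occ _==_ xs p + occ _==_ ys p
occ-++ _==_ []       ys p = refl
occ-++ _==_ (x ∷ xs) ys p =
  trans (cong (ind (p == x) +_) (occ-++ _==_ xs ys p)) (sym (+-assoc (ind (p == x)) _ _))

occ-map : ∀ {A B : Set} {_==_ : B → B → Bool} {_≈_ : A → A → Bool} (f : A → B) →
  (∀ x y → (f x == f y) ≡ (x ≈ y)) → ∀ xs x → occ _==_ (map f xs) (f x) ≡ occ _≈_ xs x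
occ-map f f-compat []       x = refl
occ-map f f-compat (y ∷ ys) x = cong₂ _+_ (cong ind (f-compat x y)) (occ-map f f-compat ys x)

matches-map : ∀ {A B : Set} {_==_ : B → B → Bool} {_≈_ : A → A → Bool} (f : A → B) →
  (∀ x y → (f x == f y) ≡ (x ≈ y)) → ∀ xs ys → matches _==_ (map f xs) (map f ys) ≡ matches _≈_ xs ys
matches-map f f-compat []       ys = refl
matches-map f f-compat (x ∷ xs) ys = cong₂ _+_ (occ-map f f-compat ys x) (matches-map f f-compat xs ys)

∧-split : ∀ {x y} → x ∧ y ≡ true → x ≡ true × y ≡ true
∧-split {true} {true} _ = refl , refl

≡ᵇ-sound : ∀ {m n} → (m ≡ᵇ n) ≡ true → m ≡ n
≡ᵇ-sound {m} {n} e = ≡ᵇ⇒≡ m n (Equivalence.from T-≡ e)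

≡ᵇ³-sound : ∀ {p q} → (p ≡ᵇ³ q) ≡ true → p ≡ q
≡ᵇ³-sound {r , s , t} {r′ , s′ , t′} e =
  let r≡r′ , e′   = ∧-split e
      s≡s′ , t≡t′ = ∧-split e′
  in cong₂ _,_ (≡ᵇ-sound r≡r′) (cong₂ _,_ (≡ᵇ-sound s≡s′) (≡ᵇ-sound t≡t′))

lookup-any : ∀ {P : Point → Set} {qs p} → All P qs → any (p ≡ᵇ³_) qs ≡ true → P p
lookup-any {P} {q ∷ qs} {p} (Pq ∷ Pqs) hit with p ≡ᵇ³ q in p≡ᵇ³q
... | true  = subst P (sym (≡ᵇ³-sound p≡ᵇ³q)) Pq
... | false = lookup-any Pqs hit

ind-any : ∀ qs p → occ _≡ᵇ³_ qs p ≤ 1 → ind (any (p ≡ᵇ³_) qs) ≡ occ _≡ᵇ³_ qs p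
ind-any []       p _     = refl
ind-any (q ∷ qs) p occ≤1 with p ≡ᵇ³ q
... | true  = cong suc (sym (n≤0⇒n≡0 (s≤s⁻¹ occ≤1)))
... | false = ind-any qs p occ≤1

Distinct : List Point → Set
Distinct qs = All (λ q → occ _≡ᵇ³_ qs q ≡ 1) qs

occ-0-or-1 : ∀ {qs rs} p → All (λ q → occ _≡ᵇ³_ qs q ≡ 1) rs →
  occ _≡ᵇ³_ rs p ≡ 0 ⊎ occ _≡ᵇ³_ qs p ≡ 1
occ-0-or-1         p []                 = inj₁ refl
occ-0-or-1 {qs} {r ∷ rs} p (occ-r≡1 ∷ all) with p ≡ᵇ³ r in p≡ᵇ³r
... | true  = inj₂ (trans (cong (occ _≡ᵇ³_ qs) (≡ᵇ³-sound p≡ᵇ³r)) occ-r≡1)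
... | false = occ-0-or-1 {qs} p all

occ≤1 : ∀ {qs} → Distinct qs → ∀ p → occ _≡ᵇ³_ qs p ≤ 1
occ≤1 {qs} distinct p with occ-0-or-1 {qs} p distinct
... | inj₁ occ≡0 = subst (_≤ 1) (sym occ≡0) z≤n
... | inj₂ occ≡1 = ≤-reflexive occ≡1

-- Inserting and deleting points

patch : Triples → List Point → List Point → Triples
patch X Ps Ms r s t = (X r s t ∨ any ((r , s , t) ≡ᵇ³_) Ps) ∧ not (any ((r , s , t) ≡ᵇ³_) Ms)

-- T is X with the points of Ps inserted and those of Ms deleted, stated additively so that it
-- makes sense in ℕ.
IsPatch : Triples → Triples → List Point → List Point → Set
IsPatch T X Ps Ms = ∀ p → ind (T ⟨ p ⟩) + occ _≡ᵇ³_ Ms p ≡ ind (X ⟨ p ⟩) + occ _≡ᵇ³_ Ps p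

ind-insert-delete : ∀ x e m → ind e + ind m ≤ 1 → (e ≡ true → x ≡ false) → (m ≡ true → x ≡ true) →
  ind ((x ∨ e) ∧ not m) + ind m ≡ ind x + ind e
ind-insert-delete _     true  true  (s≤s ()) _ _
ind-insert-delete false true  false _ _ _ = refl
ind-insert-delete true  true  false _ e⇒¬x _ with () ← e⇒¬x refl
ind-insert-delete true  false true  _ _ _ = refl
ind-insert-delete false false true  _ _ m⇒x with () ← m⇒x refl
ind-insert-delete true  false false _ _ _ = refl
ind-insert-delete false false false _ _ _ = refl

patch-isPatch : ∀ X Ps Ms → Distinct (Ps ++ Ms) →
  All (λ q → X ⟨ q ⟩ ≡ false) Ps → All (λ q → X ⟨ q ⟩ ≡ true) Ms → IsPatch (patch X Ps Ms) X Ps Ms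
patch-isPatch X Ps Ms distinct Ps∉X Ms⊆X p = begin
  ind ((x ∨ e) ∧ not m) + occ _≡ᵇ³_ Ms p
    ≡⟨ cong (ind ((x ∨ e) ∧ not m) +_) (ind-any Ms p m≤1) ⟨
  ind ((x ∨ e) ∧ not m) + ind m
    ≡⟨ ind-insert-delete x e m e+m≤1 (lookup-any Ps∉X) (lookup-any Ms⊆X) ⟩
  ind x + ind e
    ≡⟨ cong (ind x +_) (ind-any Ps p e≤1) ⟩
  ind x + occ _≡ᵇ³_ Ps p ∎
  where
  open ≡-Reasoning
  x e m : Bool
  x = X ⟨ p ⟩
  e = any (p ≡ᵇ³_) Ps
  m = any (p ≡ᵇ³_) Ms
  Ps+Ms≤1 : occ _≡ᵇ³_ Ps p + occ _≡ᵇ³_ Ms p ≤ 1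
  Ps+Ms≤1 = subst (_≤ 1) (occ-++ _≡ᵇ³_ Ps Ms p) (occ≤1 {Ps ++ Ms} distinct p)
  e≤1 : occ _≡ᵇ³_ Ps p ≤ 1
  e≤1 = ≤-trans (m≤m+n _ _) Ps+Ms≤1
  m≤1 : occ _≡ᵇ³_ Ms p ≤ 1
  m≤1 = ≤-trans (m≤n+m _ _) Ps+Ms≤1
  e+m≤1 : ind e + ind m ≤ 1
  e+m≤1 = subst₂ (λ i j → i + j ≤ 1) (sym (ind-any Ps p e≤1)) (sym (ind-any Ms p m≤1)) Ps+Ms≤1

PairInRange : ℕ → ℕ × ℕ → Set
PairInRange n (u , v) = u < n × v < n

InRange : ℕ → Point → Set
InRange n (r , p) = r < n × PairInRange n p

heads-inRange : ∀ {n qs} → All (InRange n) qs → All (PairInRange n) (map head qs)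
heads-inRange = All.map⁺ ∘ All.map (λ { (r<n , s<n , _) → r<n , s<n })

tails-inRange : ∀ {n qs} → All (InRange n) qs → All (PairInRange n) (map tail qs)
tails-inRange = All.map⁺ ∘ All.map proj₂

sum-map-+ : ∀ {A : Set} (f g : A → ℕ) xs →
  sum (map (λ x → f x + g x) xs) ≡ sum (map f xs) + sum (map g xs)
sum-map-+ f g []       = refl
sum-map-+ f g (x ∷ xs) =
  trans (cong (f x + g x +_) (sum-map-+ f g xs)) (+-interchange (f x) (g x) (sum (map f xs)) _)

sumTo-occ-first : ∀ {n qs} → All (InRange n) qs → ∀ u v →
  sumTo n (λ x → occ _≡ᵇ³_ qs (x , u , v)) ≡ occ _≡ᵇ²_ (map tail qs) (u , v)
sumTo-occ-first {n} []                   u v = sumTo-zero n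
sumTo-occ-first {n} {(r , s , t) ∷ qs} ((r<n , _) ∷ rest) u v =
  trans (sumTo-distrib-+ n _ _)
        (cong₂ _+_ (count-sift ((u , v) ≡ᵇ² (s , t)) r<n) (sumTo-occ-first rest u v))

sumTo-occ-last : ∀ {n qs} → All (InRange n) qs → ∀ u v →
  sumTo n (λ y → occ _≡ᵇ³_ qs (u , v , y)) ≡ occ _≡ᵇ²_ (map head qs) (u , v)
sumTo-occ-last {n} []                   u v = sumTo-zero n
sumTo-occ-last {n} {(r , s , t) ∷ qs} ((_ , _ , t<n) ∷ rest) u v =
  trans (sumTo-distrib-+ n _ _) (cong₂ _+_ last-sift (sumTo-occ-last rest u v))
  where
  c : Bool
  c = (u , v) ≡ᵇ² (r , s)
  last-sift : count n (λ y → (u ≡ᵇ r) ∧ (v ≡ᵇ s) ∧ (y ≡ᵇ t)) ≡ ind c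
  last-sift =
    trans (sumTo-cong n (λ y → cong ind (trans (sym (∧-assoc (u ≡ᵇ r) (v ≡ᵇ s) (y ≡ᵇ t)))
                                                (∧-comm c (y ≡ᵇ t)))))
          (count-sift c t<n)

ΣΣ-point : ∀ {n s t} (F : ℕ → ℕ → ℕ) → s < n → t < n →
  ΣΣ n (λ u v → F u v * ind ((u , v) ≡ᵇ² (s , t))) ≡ F s t
ΣΣ-point {n} {s} {t} F s<n t<n = begin
  ΣΣ n (λ u v → F u v * ind ((u ≡ᵇ s) ∧ (v ≡ᵇ t)))
    ≡⟨ ΣΣ-cong n (λ u v → trans (cong (F u v *_) (ind-∧ (u ≡ᵇ s) (v ≡ᵇ t)))
                                 (x*[y*z]≡y*[z*x] (F u v) (ind (u ≡ᵇ s)) (ind (v ≡ᵇ t)))) ⟩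
  sumTo n (λ u → sumTo n (λ v → ind (u ≡ᵇ s) * (ind (v ≡ᵇ t) * F u v)))
    ≡⟨ sumTo-cong n (λ u → trans (sumTo-*ˡ n (ind (u ≡ᵇ s)) _)
                                 (cong (ind (u ≡ᵇ s) *_) (sumTo-sift (F u) t<n))) ⟩
  sumTo n (λ u → ind (u ≡ᵇ s) * F u t)
    ≡⟨ sumTo-sift (λ u → F u t) s<n ⟩
  F s t ∎
  where
  open ≡-Reasoning
  x*[y*z]≡y*[z*x] : ∀ x y z → x * (y * z) ≡ y * (z * x)
  x*[y*z]≡y*[z*x] = solve-∀

ΣΣ-occ : ∀ {n} (F : ℕ → ℕ → ℕ) ys → All (PairInRange n) ys →
  ΣΣ n (λ u v → F u v * occ _≡ᵇ²_ ys (u , v)) ≡ sum (map (uncurry F) ys)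
ΣΣ-occ {n} F [] [] =
  trans (ΣΣ-cong n (λ u v → *-zeroʳ (F u v))) (trans (sumTo-cong n (λ _ → sumTo-zero n)) (sumTo-zero n))
ΣΣ-occ {n} F ((s , t) ∷ ys) ((s<n , t<n) ∷ rest) =
  trans (ΣΣ-cong n (λ u v → *-distribˡ-+ (F u v) _ _))
        (trans (ΣΣ-distrib-+ n _ _) (cong₂ _+_ (ΣΣ-point F s<n t<n) (ΣΣ-occ F ys rest)))

matches-comm : ∀ {n xs ys} → All (PairInRange n) xs → All (PairInRange n) ys →
  matches _≡ᵇ²_ xs ys ≡ matches _≡ᵇ²_ ys xs
matches-comm {n} {xs} {ys} xs-range ys-range = begin
  matches _≡ᵇ²_ xs ys
    ≡⟨ ΣΣ-occ (λ u v → occ _≡ᵇ²_ ys (u , v)) xs xs-range ⟨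
  ΣΣ n (λ u v → occ _≡ᵇ²_ ys (u , v) * occ _≡ᵇ²_ xs (u , v))
    ≡⟨ ΣΣ-cong n (λ u v → *-comm (occ _≡ᵇ²_ ys (u , v)) _) ⟩
  ΣΣ n (λ u v → occ _≡ᵇ²_ xs (u , v) * occ _≡ᵇ²_ ys (u , v))
    ≡⟨ ΣΣ-occ (λ u v → occ _≡ᵇ²_ xs (u , v)) ys ys-range ⟩
  matches _≡ᵇ²_ ys xs ∎
  where open ≡-Reasoning

ΣΣ-expand : ∀ {n} (i o : ℕ → ℕ → ℕ) xs ys → All (PairInRange n) xs → All (PairInRange n) ys →
  ΣΣ n (λ u v → (i u v + occ _≡ᵇ²_ xs (u , v)) * (o u v + occ _≡ᵇ²_ ys (u , v)))
  ≡ ΣΣ n (λ u v → i u v * o u v) + sum (map (uncurry i) ys) + sum (map (uncurry o) xs)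
    + matches _≡ᵇ²_ ys xs
ΣΣ-expand {n} i o xs ys xs-range ys-range = begin
  ΣΣ n (λ u v → (i u v + x u v) * (o u v + y u v))
    ≡⟨ ΣΣ-cong n (λ u v → expand (i u v) (x u v) (o u v) (y u v)) ⟩
  ΣΣ n (λ u v → i u v * o u v + i u v * y u v + o u v * x u v + x u v * y u v)
    ≡⟨ trans (ΣΣ-distrib-+ n _ _) (cong (_+ ΣΣ n (λ u v → x u v * y u v))
         (trans (ΣΣ-distrib-+ n _ _) (cong (_+ ΣΣ n (λ u v → o u v * x u v)) (ΣΣ-distrib-+ n _ _)))) ⟩
  ΣΣ n (λ u v → i u v * o u v) + ΣΣ n (λ u v → i u v * y u v) + ΣΣ n (λ u v → o u v * x u v)
    + ΣΣ n (λ u v → x u v * y u v)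
    ≡⟨ cong₂ _+_ (cong₂ _+_ (cong (_ +_) (ΣΣ-occ i ys ys-range)) (ΣΣ-occ o xs xs-range))
                 (ΣΣ-occ x ys ys-range) ⟩
  ΣΣ n (λ u v → i u v * o u v) + sum (map (uncurry i) ys) + sum (map (uncurry o) xs)
    + matches _≡ᵇ²_ ys xs ∎
  where
  open ≡-Reasoning
  x y : ℕ → ℕ → ℕ
  x u v = occ _≡ᵇ²_ xs (u , v)
  y u v = occ _≡ᵇ²_ ys (u , v)
  expand : ∀ a b c d → (a + b) * (c + d) ≡ a * c + a * d + c * b + b * d
  expand = solve-∀

module _ {n : ℕ} {T X : Triples} {Ps Ms : List Point}
         (Ps-range : All (InRange n) Ps) (Ms-range : All (InRange n) Ms)
         (T≈X : IsPatch T X Ps Ms) where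

  private
    hP tP hM tM : List (ℕ × ℕ)
    hP = map head Ps
    tP = map tail Ps
    hM = map head Ms
    tM = map tail Ms

  not-patch : ∀ p → ind (not (T ⟨ p ⟩)) + occ _≡ᵇ³_ Ps p ≡ ind (not (X ⟨ p ⟩)) + occ _≡ᵇ³_ Ms p
  not-patch p = +-cancelʳ-≡ (t + m) (t′ + e) (x′ + m) (begin
    t′ + e + (t + m)   ≡⟨ +-interchange t′ e t m ⟩
    t′ + t + (e + m)   ≡⟨ cong (_+ (e + m)) (trans (ind-not (T ⟨ p ⟩)) (sym (ind-not (X ⟨ p ⟩)))) ⟩
    x′ + x + (e + m)   ≡⟨ regroup x′ x e m ⟩
    x′ + m + (x + e)   ≡⟨ cong (x′ + m +_) (T≈X p) ⟨
    x′ + m + (t + m)   ∎)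
    where
    open ≡-Reasoning
    t t′ x x′ e m : ℕ
    t = ind (T ⟨ p ⟩)
    t′ = ind (not (T ⟨ p ⟩))
    x = ind (X ⟨ p ⟩)
    x′ = ind (not (X ⟨ p ⟩))
    e = occ _≡ᵇ³_ Ps p
    m = occ _≡ᵇ³_ Ms p
    regroup : ∀ a b c d → a + b + (c + d) ≡ a + d + (b + c)
    regroup = solve-∀

  I-patch : ∀ u v →
    I n T u v + occ _≡ᵇ²_ (map tail Ms) (u , v) ≡ I n X u v + occ _≡ᵇ²_ (map tail Ps) (u , v)
  I-patch u v = begin
    I n T u v + occ _≡ᵇ²_ tM (u , v)
      ≡⟨ cong (I n T u v +_) (sumTo-occ-first Ms-range u v) ⟨
    I n T u v + sumTo n (λ x → occ _≡ᵇ³_ Ms (x , u , v))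
      ≡⟨ sumTo-distrib-+ n _ _ ⟨
    sumTo n (λ x → ind (T x u v) + occ _≡ᵇ³_ Ms (x , u , v))
      ≡⟨ sumTo-cong n (λ x → T≈X (x , u , v)) ⟩
    sumTo n (λ x → ind (X x u v) + occ _≡ᵇ³_ Ps (x , u , v))
      ≡⟨ sumTo-distrib-+ n _ _ ⟩
    I n X u v + sumTo n (λ x → occ _≡ᵇ³_ Ps (x , u , v))
      ≡⟨ cong (I n X u v +_) (sumTo-occ-first Ps-range u v) ⟩
    I n X u v + occ _≡ᵇ²_ tP (u , v) ∎
    where open ≡-Reasoning

  Oᶜ-patch : ∀ u v →
    Oᶜ n T u v + occ _≡ᵇ²_ (map head Ps) (u , v) ≡ Oᶜ n X u v + occ _≡ᵇ²_ (map head Ms) (u , v)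
  Oᶜ-patch u v = begin
    Oᶜ n T u v + occ _≡ᵇ²_ hP (u , v)
      ≡⟨ cong (Oᶜ n T u v +_) (sumTo-occ-last Ps-range u v) ⟨
    Oᶜ n T u v + sumTo n (λ y → occ _≡ᵇ³_ Ps (u , v , y))
      ≡⟨ sumTo-distrib-+ n _ _ ⟨
    sumTo n (λ y → ind (not (T u v y)) + occ _≡ᵇ³_ Ps (u , v , y))
      ≡⟨ sumTo-cong n (λ y → not-patch (u , v , y)) ⟩
    sumTo n (λ y → ind (not (X u v y)) + occ _≡ᵇ³_ Ms (u , v , y))
      ≡⟨ sumTo-distrib-+ n _ _ ⟩
    Oᶜ n X u v + sumTo n (λ y → occ _≡ᵇ³_ Ms (u , v , y))
      ≡⟨ cong (Oᶜ n X u v +_) (sumTo-occ-last Ms-range u v) ⟩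
    Oᶜ n X u v + occ _≡ᵇ²_ hM (u , v) ∎
    where open ≡-Reasoning

  private
    ΣI ΣOᶜ : Triples → List (ℕ × ℕ) → ℕ
    ΣI S ys = sum (map (uncurry (I n S)) ys)
    ΣOᶜ S ys = sum (map (uncurry (Oᶜ n S)) ys)

    ΣI-patch : ΣI T hP + matches _≡ᵇ²_ hP tM ≡ ΣI X hP + matches _≡ᵇ²_ hP tP
    ΣI-patch = begin
      ΣI T hP + matches _≡ᵇ²_ hP tM
        ≡⟨ sum-map-+ (uncurry (I n T)) (occ _≡ᵇ²_ tM) hP ⟨
      sum (map (λ y → uncurry (I n T) y + occ _≡ᵇ²_ tM y) hP)
        ≡⟨ cong sum (map-cong (uncurry I-patch) hP) ⟩
      sum (map (λ y → uncurry (I n X) y + occ _≡ᵇ²_ tP y) hP)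
        ≡⟨ sum-map-+ (uncurry (I n X)) (occ _≡ᵇ²_ tP) hP ⟩
      ΣI X hP + matches _≡ᵇ²_ hP tP ∎
      where open ≡-Reasoning

    ΣOᶜ-patch : ΣOᶜ T tM + matches _≡ᵇ²_ hP tM ≡ ΣOᶜ X tM + matches _≡ᵇ²_ tM hM
    ΣOᶜ-patch = begin
      ΣOᶜ T tM + matches _≡ᵇ²_ hP tM
        ≡⟨ cong (ΣOᶜ T tM +_) (matches-comm (heads-inRange Ps-range) (tails-inRange Ms-range)) ⟩
      ΣOᶜ T tM + matches _≡ᵇ²_ tM hP
        ≡⟨ sum-map-+ (uncurry (Oᶜ n T)) (occ _≡ᵇ²_ hP) tM ⟨
      sum (map (λ y → uncurry (Oᶜ n T) y + occ _≡ᵇ²_ hP y) tM)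
        ≡⟨ cong sum (map-cong (uncurry Oᶜ-patch) tM) ⟩
      sum (map (λ y → uncurry (Oᶜ n X) y + occ _≡ᵇ²_ hM y) tM)
        ≡⟨ sum-map-+ (uncurry (Oᶜ n X)) (occ _≡ᵇ²_ hM) tM ⟩
      ΣOᶜ X tM + matches _≡ᵇ²_ tM hM ∎
      where open ≡-Reasoning

    Ncount-patch-raw :
      Ncount n T + ΣI T hP + ΣOᶜ T tM + matches _≡ᵇ²_ hP tM
      ≡ Ncount n X + ΣI X hM + ΣOᶜ X tP + matches _≡ᵇ²_ hM tP
    Ncount-patch-raw = begin
      Ncount n T + ΣI T hP + ΣOᶜ T tM + matches _≡ᵇ²_ hP tM
        ≡⟨ cong (λ N → N + ΣI T hP + ΣOᶜ T tM + matches _≡ᵇ²_ hP tM) (Ncount≡ΣΣ-I*Oᶜ n T) ⟩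
      ΣΣ n (λ u v → I n T u v * Oᶜ n T u v) + ΣI T hP + ΣOᶜ T tM + matches _≡ᵇ²_ hP tM
        ≡⟨ ΣΣ-expand (I n T) (Oᶜ n T) tM hP (tails-inRange Ms-range) (heads-inRange Ps-range) ⟨
      ΣΣ n (λ u v → (I n T u v + occ _≡ᵇ²_ tM (u , v)) * (Oᶜ n T u v + occ _≡ᵇ²_ hP (u , v)))
        ≡⟨ ΣΣ-cong n (λ u v → cong₂ _*_ (I-patch u v) (Oᶜ-patch u v)) ⟩
      ΣΣ n (λ u v → (I n X u v + occ _≡ᵇ²_ tP (u , v)) * (Oᶜ n X u v + occ _≡ᵇ²_ hM (u , v)))
        ≡⟨ ΣΣ-expand (I n X) (Oᶜ n X) tP hM (tails-inRange Ps-range) (heads-inRange Ms-range) ⟩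
      ΣΣ n (λ u v → I n X u v * Oᶜ n X u v) + ΣI X hM + ΣOᶜ X tP + matches _≡ᵇ²_ hM tP
        ≡⟨ cong (λ N → N + ΣI X hM + ΣOᶜ X tP + matches _≡ᵇ²_ hM tP) (Ncount≡ΣΣ-I*Oᶜ n X) ⟨
      Ncount n X + ΣI X hM + ΣOᶜ X tP + matches _≡ᵇ²_ hM tP ∎
      where open ≡-Reasoning

  Ncount-patch :
    Ncount n T + sum (map (uncurry (I n X)) (map head Ps)) + sum (map (uncurry (Oᶜ n X)) (map tail Ms))
      + matches _≡ᵇ²_ (map head Ps) (map tail Ps) + matches _≡ᵇ²_ (map tail Ms) (map head Ms)
    ≡ Ncount n X + sum (map (uncurry (I n X)) (map head Ms)) + sum (map (uncurry (Oᶜ n X)) (map tail Ps))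
      + matches _≡ᵇ²_ (map head Ms) (map tail Ps) + matches _≡ᵇ²_ (map head Ps) (map tail Ms)
  Ncount-patch = begin
    Ncount n T + ΣI X hP + ΣOᶜ X tM + matches _≡ᵇ²_ hP tP + matches _≡ᵇ²_ tM hM
      ≡⟨ regroup (Ncount n T) _ _ _ _ ⟩
    Ncount n T + (ΣI X hP + matches _≡ᵇ²_ hP tP) + (ΣOᶜ X tM + matches _≡ᵇ²_ tM hM)
      ≡⟨ cong₂ (λ A B → Ncount n T + A + B) ΣI-patch ΣOᶜ-patch ⟨
    Ncount n T + (ΣI T hP + k) + (ΣOᶜ T tM + k)
      ≡⟨ regroup (Ncount n T) _ _ _ _ ⟨
    Ncount n T + ΣI T hP + ΣOᶜ T tM + k + k
      ≡⟨ cong (_+ k) Ncount-patch-raw ⟩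
    Ncount n X + ΣI X hM + ΣOᶜ X tP + matches _≡ᵇ²_ hM tP + k ∎
    where
    open ≡-Reasoning
    k : ℕ
    k = matches _≡ᵇ²_ hP tM
    regroup : ∀ a b c d e → a + b + c + d + e ≡ a + (b + d) + (c + e)
    regroup = solve-∀

-- The seven points of T

-- All coordinates of the seven points are among the children 2a, 2a+1, 2b, 2b+1 of a and b.
-- Coding a child as (its parent is b, it is odd) turns every coincidence between the points into a
-- closed computation, once ⟦_⟧ below is shown to be injective (this is where a ≢ b is used).
Child : Set
Child = Bool × Bool

pattern a₀ = false , false
pattern a₁ = false , true
pattern b₀ = true  , false
pattern b₁ = true  , true

_==ᶜ_ : Child → Child → Bool
c ==ᶜ d = does (≡-dec Bool._≟_ Bool._≟_ c d)

-- Ncount-patch for T once evaluated: i = I_S(a,a), j = I_S(b,b), the relations imposed by H,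
-- and coincidence counts 0, 0, 6 and 1.
solve-patch-equation : ∀ {NT N iaa ibb iba oaa obb oba} →
  oaa ≡ iaa → obb ≡ ibb → oba ≡ suc ibb → iba ≡ suc iaa →
  NT + 2 * (ibb + (ibb + (iba + 0))) + 2 * (oaa + (oaa + (oba + (oba + 0)))) + 0 + 0
    ≡ 16 * N + 2 * (iaa + (iaa + (ibb + (ibb + 0)))) + 2 * (obb + (obb + (oaa + 0))) + 6 + 1 →
  NT ≡ 16 * N + 1
solve-patch-equation {NT} {N} {i} {j} refl refl refl refl eq =
  +-cancelʳ-≡ (6 * i + 8 * j + 6) NT (16 * N + 1) (trans (lhs NT i j) (trans eq (rhs N i j)))
  where
  lhs : ∀ NT i j → NT + (6 * i + 8 * j + 6)
                   ≡ NT + 2 * (j + (j + (suc i + 0))) + 2 * (i + (i + (suc j + (suc j + 0)))) + 0 + 0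
  lhs = solve-∀
  rhs : ∀ N i j → 16 * N + 2 * (i + (i + (j + (j + 0)))) + 2 * (j + (j + (i + 0))) + 6 + 1
                  ≡ 16 * N + 1 + (6 * i + 8 * j + 6)
  rhs = solve-∀

module TsetCount (q : ℕ) (S : Triples) (a b : ℕ) (a<q : a < q) (b<q : b < q) (a≢b : a ≢ b)
              (h : H q a b S) where

  parent : Child → ℕ
  parent (false , _) = a
  parent (true  , _) = b

  ⟦_⟧ : Child → ℕ
  ⟦ c@(_ , false) ⟧ = 2 * parent c
  ⟦ c@(_ , true)  ⟧ = 2 * parent c + 1

  ⟦_⟧² : Child × Child → ℕ × ℕ
  ⟦ c , d ⟧² = ⟦ c ⟧ , ⟦ d ⟧

  ⟦_⟧³ : Child × Child × Child → Point
  ⟦ c , p ⟧³ = ⟦ c ⟧ , ⟦ p ⟧²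

  parent² : Child × Child → ℕ × ℕ
  parent² (c , d) = parent c , parent d

  ⟦⟧/2 : ∀ c → ⟦ c ⟧ / 2 ≡ parent c
  ⟦⟧/2 c@(_ , false) = 2*n/2≡n (parent c)
  ⟦⟧/2 c@(_ , true)  = [2*n+1]/2≡n (parent c)

  ⟦⟧%2 : ∀ c → ⟦ c ⟧ % 2 ≡ ind (proj₂ c)
  ⟦⟧%2 c@(_ , false) = trans (%-congˡ (*-comm 2 (parent c))) (m*n%n≡0 (parent c) 2)
  ⟦⟧%2 c@(_ , true)  =
    trans (%-congˡ (trans (+-comm (2 * parent c) 1) (cong (1 +_) (*-comm 2 (parent c)))))
          ([m+kn]%n≡m%n 1 (parent c) 2)

  parent-injective : ∀ {x y i j} → parent (x , i) ≡ parent (y , j) → x ≡ y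
  parent-injective {false} {false} _   = refl
  parent-injective {false} {true}  a≡b = contradiction a≡b a≢b
  parent-injective {true}  {false} b≡a = contradiction (sym b≡a) a≢b
  parent-injective {true}  {true}  _   = refl

  ind-injective : ∀ {x y} → ind x ≡ ind y → x ≡ y
  ind-injective {false} {false} _ = refl
  ind-injective {true}  {true}  _ = refl

  ⟦⟧-injective : ∀ {c d} → ⟦ c ⟧ ≡ ⟦ d ⟧ → c ≡ d
  ⟦⟧-injective {c} {d} eq = ×-≡,≡→≡
    ( parent-injective (trans (sym (⟦⟧/2 c)) (trans (cong (_/ 2) eq) (⟦⟧/2 d)))
    , ind-injective (trans (sym (⟦⟧%2 c)) (trans (cong (_% 2) eq) (⟦⟧%2 d))) )

  ⟦⟧-≡ᵇ : ∀ c d → (⟦ c ⟧ ≡ᵇ ⟦ d ⟧) ≡ (c ==ᶜ d)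
  ⟦⟧-≡ᵇ c d = does-⇔ (mk⇔ ⟦⟧-injective (cong ⟦_⟧)) (⟦ c ⟧ ≟ ⟦ d ⟧) (≡-dec Bool._≟_ Bool._≟_ c d)

  ⟦⟧²-≡ᵇ² : ∀ x y → (⟦ x ⟧² ≡ᵇ² ⟦ y ⟧²) ≡ pairTest _==ᶜ_ x y
  ⟦⟧²-≡ᵇ² (c , d) (c′ , d′) = cong₂ _∧_ (⟦⟧-≡ᵇ c c′) (⟦⟧-≡ᵇ d d′)

  ⟦⟧³-≡ᵇ³ : ∀ x y → (⟦ x ⟧³ ≡ᵇ³ ⟦ y ⟧³) ≡ tripleTest _==ᶜ_ x y
  ⟦⟧³-≡ᵇ³ (c , p) (c′ , p′) = cong₂ _∧_ (⟦⟧-≡ᵇ c c′) (⟦⟧²-≡ᵇ² p p′)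

  parent<q : ∀ c → parent c < q
  parent<q (false , _) = a<q
  parent<q (true  , _) = b<q

  ⟦⟧<2q : ∀ c → ⟦ c ⟧ < 2 * q
  ⟦⟧<2q c@(_ , false) = *-monoʳ-< 2 (parent<q c)
  ⟦⟧<2q c@(_ , true)  =
    ≤-trans (≤-reflexive (suc[2p+1]≡2[1+p] (parent c))) (*-monoʳ-≤ 2 (parent<q c))
    where
    suc[2p+1]≡2[1+p] : ∀ p → suc (2 * p + 1) ≡ 2 * suc p
    suc[2p+1]≡2[1+p] = solve-∀

  ⟦⟧³-inRange : ∀ c → InRange (2 * q) ⟦ c ⟧³
  ⟦⟧³-inRange (c , d , e) = ⟦⟧<2q c , ⟦⟧<2q d , ⟦⟧<2q e

  lift-⟦⟧ : ∀ c d e → lift S ⟦ c ⟧ ⟦ d ⟧ ⟦ e ⟧ ≡ S (parent c) (parent d) (parent e)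
  lift-⟦⟧ c d e rewrite ⟦⟧/2 c | ⟦⟧/2 d | ⟦⟧/2 e = refl

  P₁ P₂ P₃ M₁ M₂ M₃ M₄ : Child × Child × Child
  P₁ = b₀ , b₀ , b₁
  P₂ = b₁ , b₀ , b₁
  P₃ = b₁ , a₁ , a₀
  M₁ = a₁ , a₀ , a₀
  M₂ = a₁ , a₀ , a₁
  M₃ = b₀ , b₁ , a₀
  M₄ = b₀ , b₁ , a₁

  Psᶜ Msᶜ : List (Child × Child × Child)
  Psᶜ = P₁ ∷ P₂ ∷ P₃ ∷ []
  Msᶜ = M₁ ∷ M₂ ∷ M₃ ∷ M₄ ∷ []

  Ps Ms : List Point
  Ps = map ⟦_⟧³ Psᶜ
  Ms = map ⟦_⟧³ Msᶜ

  -- _≡ᵇ³_ unfolds to eq3, so Tset and patch differ only in the trailing ∨ false of any.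
  Tset≡patch : ∀ r s t → Tset a b S r s t ≡ patch (lift S) Ps Ms r s t
  Tset≡patch r s t =
    cong₂ (λ e m → (lift S r s t ∨ test P₁ ∨ test P₂ ∨ e) ∧ not (test M₁ ∨ test M₂ ∨ test M₃ ∨ m))
          (sym (∨-identityʳ (test P₃))) (sym (∨-identityʳ (test M₄)))
    where
    test : Child × Child × Child → Bool
    test c = (r , s , t) ≡ᵇ³ ⟦ c ⟧³

  Ps++Ms-distinct : Distinct (Ps ++ Ms)
  Ps++Ms-distinct =
    All.map⁺ {f = ⟦_⟧³} (All.map (λ {c} → trans (occ-map {_==_ = _≡ᵇ³_} ⟦_⟧³ ⟦⟧³-≡ᵇ³ (Psᶜ ++ Msᶜ) c))
                                 distinctᶜ)
    where
    distinctᶜ : All (λ c → occ (tripleTest _==ᶜ_) (Psᶜ ++ Msᶜ) c ≡ 1) (Psᶜ ++ Msᶜ)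
    distinctᶜ = refl ∷ refl ∷ refl ∷ refl ∷ refl ∷ refl ∷ refl ∷ []

  Ps∉lift : All (λ p → lift S ⟨ p ⟩ ≡ false) Ps
  Ps∉lift = trans (lift-⟦⟧ b₀ b₀ b₁) (H.bbb∉ h)
          ∷ trans (lift-⟦⟧ b₁ b₀ b₁) (H.bbb∉ h)
          ∷ trans (lift-⟦⟧ b₁ a₁ a₀) (H.baa∉ h)
          ∷ []

  Ms⊆lift : All (λ p → lift S ⟨ p ⟩ ≡ true) Ms
  Ms⊆lift = trans (lift-⟦⟧ a₁ a₀ a₀) (H.aaa∈ h)
          ∷ trans (lift-⟦⟧ a₁ a₀ a₁) (H.aaa∈ h)
          ∷ trans (lift-⟦⟧ b₀ b₁ a₀) (H.bba∈ h)
          ∷ trans (lift-⟦⟧ b₀ b₁ a₁) (H.bba∈ h)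
          ∷ []

  Tset-isPatch : IsPatch (Tset a b S) (lift S) Ps Ms
  Tset-isPatch p@(r , s , t) =
    subst (λ x → ind x + occ _≡ᵇ³_ Ms p ≡ ind (lift S r s t) + occ _≡ᵇ³_ Ps p)
          (sym (Tset≡patch r s t))
          (patch-isPatch (lift S) Ps Ms Ps++Ms-distinct Ps∉lift Ms⊆lift p)

  inRange : ∀ L → All (InRange (2 * q)) (map ⟦_⟧³ L)
  inRange L = All.map⁺ (All.universal ⟦⟧³-inRange L)

  sum-lift : ∀ {F G : ℕ → ℕ → ℕ} → (∀ u v → F u v ≡ 2 * G (u / 2) (v / 2)) → ∀ L →
    sum (map (uncurry F) (map ⟦_⟧² L)) ≡ 2 * sum (map (uncurry G) (map parent² L))
  sum-lift F≡2G []            = refl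
  sum-lift {F} {G} F≡2G ((c , d) ∷ L) = begin
    F ⟦ c ⟧ ⟦ d ⟧ + sum (map (uncurry F) (map ⟦_⟧² L))
      ≡⟨ cong₂ _+_ (trans (F≡2G ⟦ c ⟧ ⟦ d ⟧) (cong₂ (λ u v → 2 * G u v) (⟦⟧/2 c) (⟦⟧/2 d)))
                   (sum-lift F≡2G L) ⟩
    2 * G (parent c) (parent d) + 2 * sum (map (uncurry G) (map parent² L))
      ≡⟨ *-distribˡ-+ 2 (G (parent c) (parent d)) _ ⟨
    2 * sum (map (uncurry G) (map parent² ((c , d) ∷ L))) ∎
    where open ≡-Reasoning

  matches-⟦⟧ : ∀ xs ys → matches _≡ᵇ²_ (map ⟦_⟧² xs) (map ⟦_⟧² ys) ≡ matches (pairTest _==ᶜ_) xs ys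
  matches-⟦⟧ = matches-map {_==_ = _≡ᵇ²_} ⟦_⟧² ⟦⟧²-≡ᵇ²

  ΣI-lift : ∀ L → sum (map (uncurry (I (2 * q) (lift S))) (map ⟦_⟧² L))
                  ≡ 2 * sum (map (uncurry (I q S)) (map parent² L))
  ΣI-lift = sum-lift (I-lift q S)

  ΣOᶜ-lift : ∀ L → sum (map (uncurry (Oᶜ (2 * q) (lift S))) (map ⟦_⟧² L))
                   ≡ 2 * sum (map (uncurry (Oᶜ q S)) (map parent² L))
  ΣOᶜ-lift = sum-lift (Oᶜ-lift q S)

  Oᶜ≡I : ∀ {u v} → I q S u v + O q S u v ≡ q → Oᶜ q S u v ≡ I q S u v
  Oᶜ≡I {u} {v} I+O≡q = +-cancelʳ-≡ (O q S u v) _ _ (trans (Oᶜ+O q S u v) (sym I+O≡q))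

  Oᶜ-ba : Oᶜ q S b a ≡ suc (I q S b b)
  Oᶜ-ba = +-cancelʳ-≡ (O q S b a) _ _
    (trans (Oᶜ+O q S b a) (trans (sym (H.cond4 h)) (+-comm (I q S b b + O q S b a) 1)))

  I-ba : I q S b a ≡ suc (I q S a a)
  I-ba = +-cancelʳ-≡ (O q S a a) _ _
    (trans (H.cond5 h) (trans (cong (_+ 1) (sym (H.cond2 h))) (+-comm (I q S a a + O q S a a) 1)))

  Ncount-Tset : Ncount (2 * q) (Tset a b S) ≡ 16 * Ncount q S + 1
  Ncount-Tset =
    solve-patch-equation {N = Ncount q S} (Oᶜ≡I (H.cond2 h)) (Oᶜ≡I (H.cond3 h)) Oᶜ-ba I-ba
      (trans (sym (+-cong₅ (refl {x = Ncount (2 * q) (Tset a b S)}) (ΣI-lift hPᶜ) (ΣOᶜ-lift tMᶜ)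
                           (matches-⟦⟧ hPᶜ tPᶜ) (matches-⟦⟧ tMᶜ hMᶜ)))
      (trans (Ncount-patch {T = Tset a b S} {X = lift S} (inRange Psᶜ) (inRange Msᶜ) Tset-isPatch)
             (+-cong₅ (Ncount-lift q S) (ΣI-lift hMᶜ) (ΣOᶜ-lift tPᶜ)
                      (matches-⟦⟧ hMᶜ tPᶜ) (matches-⟦⟧ hPᶜ tMᶜ))))
    where
    hPᶜ tPᶜ hMᶜ tMᶜ : List (Child × Child)
    hPᶜ = map head Psᶜ
    tPᶜ = map tail Psᶜ
    hMᶜ = map head Msᶜ
    tMᶜ = map tail Msᶜ

lemma3p5 : (q : ℕ) → q ≥ 1 → (S : Triples) → (a b : ℕ) → a < q → b < q → a ≢ b →
    H q a b S → Ncount (2 * q) (Tset a b S) ≡ 16 * Ncount q S + 1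
-- q ≥ 1 already follows from a < q.
lemma3p5 q _ S a b a<q b<q a≢b h = TsetCount.Ncount-Tset q S a b a<q b<q a≢b h
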